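{- For every positive integer $n$, $|\Delta(n)|$ equals the number of partitions of $n$ into distinct parts, which in turn equals the number of partitions of $n$ into odd parts.
   Context: For a partition $\alpha=(\alpha_1\ge\dots\ge\alpha_t\ge1)$ of $n$ (with $\alpha_i=0$ for $i>t$) its diagonal sequence is $\delta(\alpha)=(d_k)_{k\ge1}$ with $d_k=\big|\{i:1\le i\le k,\ \alpha_i+i-1\ge k\}\big|$. $\Delta(n)$ is the set of diagonal sequences of all partitions of $n$. -}

module Defs where

open import Data.Nat using (ℕ; zero; suc; _+_; _*_; _∸_; _≤_; _<_; _≥_; _>_; _≤?_)
open import Data.List using (List; []; _∷_; length; filter; map; upTo)
open import Data.Nat.ListAction using (sum)
open import Data.List.Relation.Unary.All using (All)
open import Data.List.Relation.Unary.Any using (Any)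
open import Data.List.Relation.Unary.AllPairs using (AllPairs)
open import Data.Product using (Σ; ∃; _×_)
open import Relation.Binary.PropositionalEquality using (_≡_)
open import Relation.Nullary using (¬_)

IsPartition : ℕ → List ℕ → Set
IsPartition n α = AllPairs _≥_ α × All (λ a → 1 ≤ a) α × sum α ≡ n

IsDistinctPartition : ℕ → List ℕ → Set
IsDistinctPartition n α = AllPairs _>_ α × All (λ a → 1 ≤ a) α × sum α ≡ n

Odd : ℕ → Set
Odd a = ∃ λ k → a ≡ suc (2 * k)

-- Partition into odd parts (odd parts are automatically ≥ 1).
IsOddPartition : ℕ → List ℕ → Set
IsOddPartition n α = AllPairs _≥_ α × All Odd α × sum α ≡ n

-- α_i with 1-based index i, and α_i = 0 beyond the length (α_0 unused).
part : List ℕ → ℕ → ℕ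
part []      _             = 0
part (a ∷ α) zero          = 0
part (a ∷ α) (suc zero)    = a
part (a ∷ α) (suc (suc i)) = part α (suc i)

diag : List ℕ → ℕ → ℕ
diag α k = length (filter (λ i → k ≤? part α i + i ∸ 1) (map suc (upTo k)))

-- A sequence (d_k)_{k ≥ 1} is represented as s : ℕ → ℕ with s j = d_{j+1}.
-- Δ(n): sequences (pointwise) equal to the diagonal sequence of some partition of n.
InΔ : ℕ → (ℕ → ℕ) → Set
InΔ n s = ∃ λ α → IsPartition n α × (∀ j → s j ≡ diag α (suc j))

HasSize : {A : Set} → (A → A → Set) → (A → Set) → ℕ → Set
HasSize {A} _≈_ P m =
  Σ (List A) λ xs →
    length xs ≡ m × All P xs × AllPairs (λ a b → ¬ (a ≈ b)) xs
    × (∀ a → P a → Any (λ b → a ≈ b) xs)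

_≗ₛ_ : (ℕ → ℕ) → (ℕ → ℕ) → Set
s ≗ₛ t = ∀ j → s j ≡ t j

-- Shift row i of a partition i − 1 cells to the right: then d_k is the number of rows covering
-- column k. Adding the rows of a partition one at a time, and moving cells between adjacent rows
-- where needed, keeps these column counts and ends in a partition into distinct parts. A partition
-- into distinct parts is determined by its diagonal sequence: its largest part x is the last k with
-- d_k ≠ 0, and d_{k+1} − [k < x] is the diagonal sequence of the remaining rows. So Δ(n) is in
-- bijection with the partitions of n into distinct parts, which are enumerated explicitly.
-- Glaisher's bijection to partitions into odd parts keeps the odd parts and turns an even part 2m
-- into two parts m, recursively.

module Submission where

open import Data.List using (List; []; _∷_; length; filter; map; upTo; applyUpTo; foldr; _++_)
open import Data.List.Membership.Propositional.Properties using (∈-filter⁺)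
open import Data.List.Properties
  using (∷-injectiveʳ; filter-accept; filter-reject; filter-none; filter-all; length-map; map-upTo; map-applyUpTo)
open import Data.List.Relation.Unary.All as All using (All; []; _∷_)
import Data.List.Relation.Unary.All.Properties as All
open import Data.List.Relation.Unary.AllPairs as AllPairs using (AllPairs; []; _∷_)
import Data.List.Relation.Unary.AllPairs.Properties as AllPairs
open import Data.List.Relation.Unary.Any as Any using (Any; here)
import Data.List.Relation.Unary.Any.Properties as Any
open import Data.Nat
  using (ℕ; zero; suc; _+_; _*_; _∸_; ⌊_/2⌋; parity; _≤_; _<_; _≥_; _>_; _<?_; _≟_; z≤n; s≤s; z<s; s<s; s≤s⁻¹)
open import Data.Nat.ListAction using (sum)
open import Data.Parity.Base using (1ℙ)
import Data.Parity.Properties as ℙ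
open import Data.Nat.Properties
open import Data.Product using (Σ; _×_; _,_; proj₁; proj₂; map₂)
open import Function using (_∘_)
open import Relation.Binary using (tri<; tri≈; tri>)
open import Relation.Binary.PropositionalEquality
open import Relation.Nullary using (¬_; yes; no; contradiction)
open import Relation.Unary using (Decidable; _≐_; ∁)
open import Relation.Unary.Properties using (∁?)

open import Algebra.Properties.CommutativeSemigroup +-commutativeSemigroup using (x∙yz≈y∙xz)

open import Defs

Positive Decreasing Nonincreasing : List ℕ → Set
Positive      = All (1 ≤_)
Decreasing    = AllPairs _>_
Nonincreasing = AllPairs _≥_

-- Diagonal sequences

module _ {P Q : ℕ → Set} (P? : Decidable P) (Q? : Decidable Q) where

  length-filter-map : ∀ (h : ℕ → ℕ) → P ∘ h ≐ Q → ∀ xs →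
                      length (filter P? (map h xs)) ≡ length (filter Q? xs)
  length-filter-map h P∘h≐Q [] = refl
  length-filter-map h P∘h≐Q@(to , from) (x ∷ xs) with Q? x
  ... | yes q = trans (cong length (filter-accept P? (from q)))
                      (cong suc (length-filter-map h P∘h≐Q xs))
  ... | no ¬q = trans (cong length (filter-reject P? (¬q ∘ to)))
                      (length-filter-map h P∘h≐Q xs)

𝟙[_<_] : ℕ → ℕ → ℕ
𝟙[ j     < zero  ] = 0
𝟙[ zero  < suc a ] = 1
𝟙[ suc j < suc a ] = 𝟙[ j < a ]

𝟙[<]≡1 : ∀ {j a} → j < a → 𝟙[ j < a ] ≡ 1
𝟙[<]≡1 {zero}  {suc a} _         = refl
𝟙[<]≡1 {suc j} {suc a} (s≤s j<a) = 𝟙[<]≡1 j<a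

𝟙[<]≡0 : ∀ {j a} → ¬ j < a → 𝟙[ j < a ] ≡ 0
𝟙[<]≡0 {_}     {zero}  _   = refl
𝟙[<]≡0 {zero}  {suc a} j≮a = contradiction z<s j≮a
𝟙[<]≡0 {suc j} {suc a} j≮a = 𝟙[<]≡0 (j≮a ∘ s<s)

diagonal : List ℕ → ℕ → ℕ
diagonal []      _       = 0
diagonal (a ∷ β) zero    = 𝟙[ 0 < a ]
diagonal (a ∷ β) (suc j) = 𝟙[ suc j < a ] + diagonal β j

diag-[] : ∀ k → diag [] k ≡ 0
diag-[] k = begin
  length (filter P? (map suc (upTo k))) ≡⟨ cong (length ∘ filter P?) (map-upTo suc k) ⟩
  length (filter P? (applyUpTo suc k))  ≡⟨ cong length (filter-none P? (All.applyUpTo⁺₁ suc k <⇒≱)) ⟩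
  0                                     ∎
  where
  open ≡-Reasoning
  P? = λ i → k ≤? part [] i + i ∸ 1

diag-∷ : ∀ a β j → diag (a ∷ β) (suc j) ≡ 𝟙[ j < a ] + diag β j
diag-∷ a β j = begin
  length (filter P? (1 ∷ map suc (applyUpTo suc j)))          ≡⟨ first-row ⟩
  𝟙[ j < a ] + length (filter P? (map suc (applyUpTo suc j))) ≡⟨ cong (𝟙[ j < a ] +_) other-rows ⟩
  𝟙[ j < a ] + diag β j                                       ∎
  where
  open ≡-Reasoning
  P? = λ i → suc j ≤? part (a ∷ β) i + i ∸ 1
  Q? = λ i → j ≤? part β i + i ∸ 1
  R? = λ i → j ≤? part β (suc i) + i

  first-row : ∀ {xs} → length (filter P? (1 ∷ xs)) ≡ 𝟙[ j < a ] + length (filter P? xs)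
  first-row {xs} with suc j ≤? a
  ... | yes j<a = trans (cong length (filter-accept P? {1} {xs} (subst (suc j ≤_) (sym (m+n∸n≡m a 1)) j<a)))
                        (cong (_+ length (filter P? xs)) (sym (𝟙[<]≡1 j<a)))
  ... | no  j≮a = trans (cong length (filter-reject P? {1} {xs} (j≮a ∘ subst (suc j ≤_) (m+n∸n≡m a 1))))
                        (cong (_+ length (filter P? xs)) (sym (𝟙[<]≡0 j≮a)))

  row-end : ∀ p i → p + suc i ∸ 1 ≡ p + i
  row-end p i = cong (_∸ 1) (+-suc p i)

  shifted : ∀ i → suc j ≤ part β (suc i) + suc (suc i) ∸ 1 → j ≤ part β (suc i) + i
  shifted i = s≤s⁻¹ ∘ subst (suc j ≤_) (trans (row-end _ (suc i)) (+-suc _ i))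

  unshifted : ∀ i → j ≤ part β (suc i) + i → suc j ≤ part β (suc i) + suc (suc i) ∸ 1
  unshifted i = subst (suc j ≤_) (sym (trans (row-end _ (suc i)) (+-suc _ i))) ∘ s≤s

  other-rows : length (filter P? (map suc (applyUpTo suc j))) ≡ diag β j
  other-rows = begin
    length (filter P? (map suc (applyUpTo suc j)))
      ≡⟨ cong (length ∘ filter P?) (trans (map-applyUpTo suc suc j) (sym (map-upTo (suc ∘ suc) j))) ⟩
    length (filter P? (map (suc ∘ suc) (upTo j)))
      ≡⟨ length-filter-map P? R? (suc ∘ suc) ((λ {i} → shifted i) , λ {i} → unshifted i) (upTo j) ⟩
    length (filter R? (upTo j))
      ≡⟨ length-filter-map Q? R? suc ((λ {i} → subst (j ≤_) (row-end _ i)) ,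
                                     λ {i} → subst (j ≤_) (sym (row-end _ i))) (upTo j) ⟨
    diag β j ∎

δ : List ℕ → ℕ → ℕ
δ α j = diag α (suc j)

δ≡diagonal : ∀ α j → δ α j ≡ diagonal α j
δ≡diagonal []      j       = diag-[] (suc j)
δ≡diagonal (a ∷ β) zero    = trans (diag-∷ a β 0) (+-identityʳ _)
δ≡diagonal (a ∷ β) (suc j) = trans (diag-∷ a β (suc j)) (cong (_ +_) (δ≡diagonal β j))

-- For x ≥ a, rows of lengths a and x at heights i and i + 1 cover the same diagonals as rows of
-- lengths x + 1 and a − 1 there.
insertRow : ℕ → List ℕ → List ℕ
insertRow zero    ls       = ls
insertRow (suc a) []       = suc a ∷ []
insertRow (suc a) (x ∷ ls) with x <? suc a
... | yes _ = suc a ∷ x ∷ ls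
... | no  _ = suc x ∷ insertRow a ls

toDistinct : List ℕ → List ℕ
toDistinct = foldr insertRow []

diagonal-insertRow : ∀ a ls → length ls ≤ a → ∀ j → diagonal (insertRow a ls) j ≡ diagonal (a ∷ ls) j
diagonal-insertRow zero    []       _ zero    = refl
diagonal-insertRow zero    []       _ (suc j) = refl
diagonal-insertRow (suc a) []       _ j       = refl
diagonal-insertRow (suc a) (x ∷ ls) (s≤s ∣ls∣≤a) j with x <? suc a
... | yes _ = refl
... | no  _ with j
...   | zero        = refl
...   | suc zero    = trans (cong (𝟙[ 0 < x ] +_) (diagonal-insertRow a ls ∣ls∣≤a 0))
                            (+-comm 𝟙[ 0 < x ] 𝟙[ 0 < a ])
...   | suc (suc j) = trans (cong (𝟙[ suc j < x ] +_) (diagonal-insertRow a ls ∣ls∣≤a (suc j)))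
                            (x∙yz≈y∙xz 𝟙[ suc j < x ] 𝟙[ suc j < a ] (diagonal ls j))

insertRow-≤ : ∀ {b} a ls → a < b → All (_< b) ls → All (_≤ b) (insertRow a ls)
insertRow-≤ zero    ls       a<b ls<b         = All.map <⇒≤ ls<b
insertRow-≤ (suc a) []       a<b []           = <⇒≤ a<b ∷ []
insertRow-≤ (suc a) (x ∷ ls) a<b (x<b ∷ ls<b) with x <? suc a
... | yes _ = <⇒≤ a<b ∷ <⇒≤ x<b ∷ All.map <⇒≤ ls<b
... | no  _ = x<b ∷ insertRow-≤ a ls (<-trans (n<1+n a) a<b) ls<b

insertRow-decreasing : ∀ a ls → Decreasing ls → Decreasing (insertRow a ls)
insertRow-decreasing zero    ls       ls↘ = ls↘
insertRow-decreasing (suc a) []       ls↘ = [] ∷ []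
insertRow-decreasing (suc a) (x ∷ ls) (ls<x ∷ ls↘) with x <? suc a
... | yes x<a = (x<a ∷ All.map (λ y<x → <-trans y<x x<a) ls<x) ∷ ls<x ∷ ls↘
... | no  x≮a = All.map s≤s (insertRow-≤ a ls (≤-trans (n<1+n a) (≮⇒≥ x≮a)) ls<x)
              ∷ insertRow-decreasing a ls ls↘

insertRow-positive : ∀ a ls → Positive ls → Positive (insertRow a ls)
insertRow-positive zero    ls       ls⁺ = ls⁺
insertRow-positive (suc a) []       ls⁺ = s≤s z≤n ∷ []
insertRow-positive (suc a) (x ∷ ls) (x⁺ ∷ ls⁺) with x <? suc a
... | yes _ = s≤s z≤n ∷ x⁺ ∷ ls⁺
... | no  _ = s≤s z≤n ∷ insertRow-positive a ls ls⁺

length≤head : ∀ x ls → Decreasing (x ∷ ls) → Positive (x ∷ ls) → length (x ∷ ls) ≤ x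
length≤head x []       _                   (x⁺ ∷ _)  = x⁺
length≤head x (y ∷ ls) ((y<x ∷ _) ∷ ys↘)   (_ ∷ ys⁺) = ≤-trans (s≤s (length≤head y ls ys↘ ys⁺)) y<x

length-insertRow : ∀ a ls → Decreasing ls → Positive ls → length ls ≤ a → length (insertRow a ls) ≤ a
length-insertRow zero    ls       _ _ ∣ls∣≤a = ∣ls∣≤a
length-insertRow (suc a) []       _ _ _      = s≤s z≤n
length-insertRow (suc a) (x ∷ ls) xs↘@(_ ∷ ls↘) xs⁺@(_ ∷ ls⁺) (s≤s ∣ls∣≤a) with x <? suc a
... | yes (s≤s x≤a) = s≤s (≤-trans (length≤head x ls xs↘ xs⁺) x≤a)
... | no  _         = s≤s (length-insertRow a ls ls↘ ls⁺ ∣ls∣≤a)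

sum-insertRow : ∀ a ls → sum (insertRow a ls) ≡ a + sum ls
sum-insertRow zero    ls       = refl
sum-insertRow (suc a) []       = refl
sum-insertRow (suc a) (x ∷ ls) with x <? suc a
... | yes _ = refl
... | no  _ = cong suc (trans (cong (x +_) (sum-insertRow a ls)) (x∙yz≈y∙xz x a (sum ls)))

toDistinct-decreasing : ∀ α → Decreasing (toDistinct α)
toDistinct-decreasing []      = []
toDistinct-decreasing (a ∷ α) = insertRow-decreasing a _ (toDistinct-decreasing α)

toDistinct-positive : ∀ α → Positive (toDistinct α)
toDistinct-positive []      = []
toDistinct-positive (a ∷ α) = insertRow-positive a _ (toDistinct-positive α)

sum-toDistinct : ∀ α → sum (toDistinct α) ≡ sum α
sum-toDistinct []      = refl
sum-toDistinct (a ∷ α) = trans (sum-insertRow a _) (cong (a +_) (sum-toDistinct α))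

length-toDistinct : ∀ {b} α → Nonincreasing α → All (_≤ b) α → length (toDistinct α) ≤ b
length-toDistinct []      _          _         = z≤n
length-toDistinct (a ∷ α) (α≤a ∷ α↘) (a≤b ∷ _) =
  ≤-trans (length-insertRow a _ (toDistinct-decreasing α) (toDistinct-positive α)
                            (length-toDistinct α α↘ α≤a))
          a≤b

diagonal-toDistinct : ∀ α → Nonincreasing α → ∀ j → diagonal (toDistinct α) j ≡ diagonal α j
diagonal-toDistinct []      _          j       = refl
diagonal-toDistinct (a ∷ α) (α≤a ∷ α↘) zero    = diagonal-insertRow a _ (length-toDistinct α α↘ α≤a) 0
diagonal-toDistinct (a ∷ α) (α≤a ∷ α↘) (suc j) =
  trans (diagonal-insertRow a _ (length-toDistinct α α↘ α≤a) (suc j))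
        (cong (𝟙[ suc j < a ] +_) (diagonal-toDistinct α α↘ j))

diagonal-vanishes : ∀ {b} ls → Decreasing ls → All (_< b) ls → ∀ j → b ≤ suc j → diagonal ls j ≡ 0
diagonal-vanishes []       _           _          _       _    = refl
diagonal-vanishes (x ∷ ls) _           (x<b ∷ _)  zero    b≤1  =
  𝟙[<]≡0 (≤⇒≯ (s≤s⁻¹ (≤-trans x<b b≤1)))
diagonal-vanishes (x ∷ ls) (ls<x ∷ ls↘) (x<b ∷ _) (suc j) b≤j+2 =
  cong₂ _+_ (𝟙[<]≡0 (≤⇒≯ x≤j+1)) (diagonal-vanishes ls ls↘ ls<x j x≤j+1)
  where x≤j+1 = s≤s⁻¹ (≤-trans x<b b≤j+2)

diagonal-∷-positive : ∀ {y} μ j → j < y → 0 < diagonal (y ∷ μ) j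
diagonal-∷-positive μ zero    j<y = ≤-reflexive (sym (𝟙[<]≡1 j<y))
diagonal-∷-positive μ (suc j) j<y = ≤-trans (≤-reflexive (sym (𝟙[<]≡1 j<y))) (m≤m+n _ _)

diagonal-head-< : ∀ {x y} ls μ → Decreasing (x ∷ ls) → x < y → diagonal (x ∷ ls) x ≢ diagonal (y ∷ μ) x
diagonal-head-< {x} ls μ xs↘ x<y eq =
  <⇒≢ (diagonal-∷-positive μ x x<y)
       (sym (trans (sym eq) (diagonal-vanishes (x ∷ ls) xs↘ xs<x+1 x ≤-refl)))
  where xs<x+1 = ≤-refl ∷ All.map m≤n⇒m≤1+n (AllPairs.head xs↘)

diagonal-injective : ∀ ls μ → Decreasing ls → Positive ls → Decreasing μ → Positive μ →
                     (∀ j → diagonal ls j ≡ diagonal μ j) → ls ≡ μ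
diagonal-injective []       []      _   _          _   _          eq = refl
diagonal-injective []       (y ∷ μ) _   _          _   (y⁺ ∷ _)   eq =
  contradiction (eq 0) (<⇒≢ (diagonal-∷-positive μ 0 y⁺))
diagonal-injective (x ∷ ls) []      _   (x⁺ ∷ _)   _   _          eq =
  contradiction (sym (eq 0)) (<⇒≢ (diagonal-∷-positive ls 0 x⁺))
diagonal-injective (x ∷ ls) (y ∷ μ) xs↘ (_ ∷ ls⁺) ys↘ (_ ∷ μ⁺) eq with <-cmp x y
... | tri< x<y _ _ = contradiction (eq x) (diagonal-head-< ls μ xs↘ x<y)
... | tri> _ _ y<x = contradiction (sym (eq y)) (diagonal-head-< μ ls ys↘ y<x)
... | tri≈ _ refl _ = cong (x ∷_) (diagonal-injective ls μ (AllPairs.tail xs↘) ls⁺ (AllPairs.tail ys↘) μ⁺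
                                     (λ j → +-cancelˡ-≡ 𝟙[ suc j < x ] _ _ (eq (suc j))))

δ-toDistinct : ∀ α → Nonincreasing α → δ (toDistinct α) ≗ₛ δ α
δ-toDistinct α α↘ j = begin
  δ (toDistinct α) j        ≡⟨ δ≡diagonal (toDistinct α) j ⟩
  diagonal (toDistinct α) j ≡⟨ diagonal-toDistinct α α↘ j ⟩
  diagonal α j              ≡⟨ δ≡diagonal α j ⟨
  δ α j                     ∎
  where open ≡-Reasoning

δ-injective : ∀ ls μ → Decreasing ls → Positive ls → Decreasing μ → Positive μ → δ ls ≗ₛ δ μ → ls ≡ μ
δ-injective ls μ ls↘ ls⁺ μ↘ μ⁺ δls≗δμ = diagonal-injective ls μ ls↘ ls⁺ μ↘ μ⁺ λ j →
  trans (sym (δ≡diagonal ls j)) (trans (δls≗δμ j) (δ≡diagonal μ j))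

-- Counting partitions into distinct parts

module _ {A B : Set} {P : A → Set} {Q : B → Set} {_≈_ : B → B → Set} (f : A → B) where

  HasSize-map : ∀ {m} → (∀ {a} → P a → Q (f a)) → (∀ {a b} → P a → P b → f a ≈ f b → a ≡ b) →
                (∀ {y} → Q y → Σ A λ a → P a × y ≈ f a) → HasSize _≡_ P m → HasSize _≈_ Q m
  HasSize-map P⇒Q f-injective f-onto (xs , ∣xs∣≡m , P[xs] , xs-unique , P⊆xs) =
    map f xs ,
    trans (length-map f xs) ∣xs∣≡m ,
    All.map⁺ (All.map P⇒Q P[xs]) ,
    map-unique P[xs] xs-unique ,
    λ y Qy → let (a , Pa , y≈fa) = f-onto Qy in
             Any.map⁺ (Any.map (λ { refl → y≈fa }) (P⊆xs a Pa))
    where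
    map-unique : ∀ {xs} → All P xs → AllPairs (λ a b → ¬ a ≡ b) xs → AllPairs (λ u v → ¬ u ≈ v) (map f xs)
    map-unique []          []              = []
    map-unique (Px ∷ P[xs]) (x∉xs ∷ xs-unique) =
      All.map⁺ (All.zipWith (λ (Py , x≢y) fx≈fy → x≢y (f-injective Px Py fx≈fy)) (P[xs] , x∉xs))
      ∷ map-unique P[xs] xs-unique

Bounded : ℕ → List ℕ → Set
Bounded k xs = Decreasing xs × Positive xs × All (_≤ k) xs

decreasingLists : ℕ → List (List ℕ)
decreasingLists zero    = [] ∷ []
decreasingLists (suc k) = map (suc k ∷_) (decreasingLists k) ++ decreasingLists k

decreasingLists-bounded : ∀ k → All (Bounded k) (decreasingLists k)
decreasingLists-bounded zero    = ([] , [] , []) ∷ []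
decreasingLists-bounded (suc k) = All.++⁺ (All.map⁺ (All.map with-head (decreasingLists-bounded k)))
                                          (All.map weaken (decreasingLists-bounded k))
  where
  weaken : ∀ {xs} → Bounded k xs → Bounded (suc k) xs
  weaken (xs↘ , xs⁺ , xs≤k) = xs↘ , xs⁺ , All.map m≤n⇒m≤1+n xs≤k
  with-head : ∀ {xs} → Bounded k xs → Bounded (suc k) (suc k ∷ xs)
  with-head (xs↘ , xs⁺ , xs≤k) =
    All.map s≤s xs≤k ∷ xs↘ , s≤s z≤n ∷ xs⁺ , ≤-refl ∷ All.map m≤n⇒m≤1+n xs≤k

decreasingLists-unique : ∀ k → AllPairs (λ xs ys → ¬ xs ≡ ys) (decreasingLists k)
decreasingLists-unique zero    = [] ∷ []
decreasingLists-unique (suc k) =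
  AllPairs.++⁺ (AllPairs.map⁺ (AllPairs.map (_∘ ∷-injectiveʳ) (decreasingLists-unique k)))
               (decreasingLists-unique k)
               (All.map⁺ (All.map (λ _ → All.map (λ { (_ , _ , k+1≤k ∷ _) refl → 1+n≰n k+1≤k })
                                                 (decreasingLists-bounded k))
                                  (decreasingLists-bounded k)))

decreasingLists-complete : ∀ k xs → Bounded k xs → Any (xs ≡_) (decreasingLists k)
decreasingLists-complete zero    []       _                       = here refl
decreasingLists-complete zero    (x ∷ xs) (_ , x⁺ ∷ _ , x≤0 ∷ _)  = contradiction x≤0 (<⇒≱ x⁺)
decreasingLists-complete (suc k) []       _                       =
  Any.++⁺ʳ _ (decreasingLists-complete k [] ([] , [] , []))
decreasingLists-complete (suc k) (x ∷ xs) (xs<x ∷ xs↘ , x⁺ ∷ xs⁺ , x≤k+1 ∷ _) with x ≟ suc k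
... | yes refl = Any.++⁺ˡ (Any.map⁺ (Any.map (cong (suc k ∷_))
                   (decreasingLists-complete k xs (xs↘ , xs⁺ , All.map s≤s⁻¹ xs<x))))
... | no  x≢k+1 = Any.++⁺ʳ _ (decreasingLists-complete k (x ∷ xs)
                   (xs<x ∷ xs↘ , x⁺ ∷ xs⁺ , x≤k ∷ All.map (λ y<x → ≤-trans (<⇒≤ y<x) x≤k) xs<x))
  where x≤k = s≤s⁻¹ (≤∧≢⇒< x≤k+1 x≢k+1)

All-≤-sum : ∀ xs → All (_≤ sum xs) xs
All-≤-sum []       = []
All-≤-sum (x ∷ xs) = m≤m+n x (sum xs) ∷ All.map (λ y≤ → ≤-trans y≤ (m≤n+m (sum xs) x)) (All-≤-sum xs)

distinctPartitions : ℕ → List (List ℕ)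
distinctPartitions n = filter (λ xs → sum xs ≟ n) (decreasingLists n)

distinctPartitions-hasSize : ∀ n → HasSize _≡_ (IsDistinctPartition n) (length (distinctPartitions n))
distinctPartitions-hasSize n =
  distinctPartitions n ,
  refl ,
  All.zipWith (λ ((xs↘ , xs⁺ , _) , Σxs≡n) → xs↘ , xs⁺ , Σxs≡n)
              (All.filter⁺ sum≟n (decreasingLists-bounded n) , All.all-filter sum≟n (decreasingLists n)) ,
  AllPairs.filter⁺ sum≟n (decreasingLists-unique n) ,
  λ xs (xs↘ , xs⁺ , Σxs≡n) →
    let xs≤n = subst (λ s → All (_≤ s) xs) Σxs≡n (All-≤-sum xs)
    in ∈-filter⁺ sum≟n (decreasingLists-complete n xs (xs↘ , xs⁺ , xs≤n)) Σxs≡n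
  where sum≟n = λ xs → sum xs ≟ n

Δ-hasSize : ∀ n → HasSize _≗ₛ_ (InΔ n) (length (distinctPartitions n))
Δ-hasSize n = HasSize-map δ in-Δ injective onto (distinctPartitions-hasSize n)
  where
  in-Δ : ∀ {l} → IsDistinctPartition n l → InΔ n (δ l)
  in-Δ {l} (l↘ , l⁺ , Σl) = l , (AllPairs.map <⇒≤ l↘ , l⁺ , Σl) , λ _ → refl
  injective : ∀ {a b} → IsDistinctPartition n a → IsDistinctPartition n b → δ a ≗ₛ δ b → a ≡ b
  injective {a} {b} (a↘ , a⁺ , _) (b↘ , b⁺ , _) = δ-injective a b a↘ a⁺ b↘ b⁺
  onto : ∀ {s} → InΔ n s → Σ (List ℕ) λ l → IsDistinctPartition n l × s ≗ₛ δ l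
  onto (α , (α↘ , _ , Σα) , s≗δα) =
    toDistinct α ,
    (toDistinct-decreasing α , toDistinct-positive α , trans (sum-toDistinct α) Σα) ,
    λ j → trans (s≗δα j) (sym (δ-toDistinct α α↘ j))

-- Merging nonincreasing lists

merge : List ℕ → List ℕ → List ℕ
merge []       ys = ys
merge (x ∷ xs) ys = merge-with ys
  where
  merge-with : List ℕ → List ℕ
  merge-with []       = x ∷ xs
  merge-with (y ∷ ys) with y <? x
  ... | yes _ = x ∷ merge xs (y ∷ ys)
  ... | no  _ = y ∷ merge-with ys

merge-[]ʳ : ∀ xs → merge xs [] ≡ xs
merge-[]ʳ []       = refl
merge-[]ʳ (x ∷ xs) = refl

merge-∷ʳ : ∀ xs y ys → All (_≤ y) xs → merge xs (y ∷ ys) ≡ y ∷ merge xs ys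
merge-∷ʳ []       y ys _         = refl
merge-∷ʳ (x ∷ xs) y ys (x≤y ∷ _) with y <? x
... | yes y<x = contradiction x≤y (<⇒≱ y<x)
... | no  _   = refl

merge-∷ˡ : ∀ x xs ys → All (_≤ x) xs → All (_≤ x) ys → merge (x ∷ xs) ys ≡ x ∷ merge xs ys
merge-∷ˡ x xs []       _    _                = cong (x ∷_) (sym (merge-[]ʳ xs))
merge-∷ˡ x xs (y ∷ ys) xs≤x (y≤x ∷ ys≤x) with y <? x
... | yes _   = refl
... | no  y≮x with ≤-antisym y≤x (≮⇒≥ y≮x)
...   | refl  = cong (x ∷_) (trans (merge-∷ˡ x xs ys xs≤x ys≤x) (sym (merge-∷ʳ xs x ys xs≤x)))

merge-All : ∀ {P : ℕ → Set} {xs ys} → All P xs → All P ys → All P (merge xs ys)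
merge-All {xs = []}         _                        P[ys] = P[ys]
merge-All {P} {xs = x ∷ xs} P[x∷xs]@(Px ∷ P[xs]) = go
  where
  go : ∀ {ys} → All P ys → All P (merge (x ∷ xs) ys)
  go {[]}     _            = P[x∷xs]
  go {y ∷ ys} (Py ∷ P[ys]) with y <? x
  ... | yes _ = Px ∷ merge-All P[xs] (Py ∷ P[ys])
  ... | no  _ = Py ∷ go P[ys]

merge-decreasing : ∀ {P : ℕ → Set} {xs ys} → All P xs → All (∁ P) ys →
                   Decreasing xs → Decreasing ys → Decreasing (merge xs ys)
merge-decreasing {xs = []}         _            _  _                    ys↘ = ys↘
merge-decreasing {P} {xs = x ∷ xs} (Px ∷ P[xs]) ¬P x∷xs↘@(xs<x ∷ xs↘) = go ¬P
  where
  go : ∀ {ys} → All (∁ P) ys → Decreasing ys → Decreasing (merge (x ∷ xs) ys)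
  go {[]}     _              _            = x∷xs↘
  go {y ∷ ys} (¬Py ∷ ¬P[ys]) (ys<y ∷ ys↘) with y <? x
  ... | yes y<x = merge-All xs<x (y<x ∷ All.map (λ z<y → <-trans z<y y<x) ys<y)
                ∷ merge-decreasing P[xs] (¬Py ∷ ¬P[ys]) xs↘ (ys<y ∷ ys↘)
  ... | no  y≮x = merge-All (x<y ∷ All.map (λ z<x → <-trans z<x x<y) xs<x) ys<y
                ∷ go ¬P[ys] ys↘
    where x<y = ≤∧≢⇒< (≮⇒≥ y≮x) (λ { refl → ¬Py Px })

sum-merge : ∀ xs ys → sum (merge xs ys) ≡ sum xs + sum ys
sum-merge []       ys = refl
sum-merge (x ∷ xs) ys = go ys
  where
  go : ∀ ys → sum (merge (x ∷ xs) ys) ≡ x + sum xs + sum ys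
  go []       = sym (+-identityʳ _)
  go (y ∷ ys) with y <? x
  ... | yes _ = trans (cong (x +_) (sum-merge xs (y ∷ ys))) (sym (+-assoc x (sum xs) _))
  ... | no  _ = trans (cong (y +_) (go ys)) (x∙yz≈y∙xz y (x + sum xs) (sum ys))

merge-nonincreasing : ∀ {xs ys} → Nonincreasing xs → Nonincreasing ys → Nonincreasing (merge xs ys)
merge-nonincreasing {[]}     _                      ys↘ = ys↘
merge-nonincreasing {x ∷ xs} x∷xs↘@(xs≤x ∷ xs↘) = go
  where
  go : ∀ {ys} → Nonincreasing ys → Nonincreasing (merge (x ∷ xs) ys)
  go {[]}     _            = x∷xs↘
  go {y ∷ ys} (ys≤y ∷ ys↘) with y <? x
  ... | yes y<x = merge-All xs≤x (<⇒≤ y<x ∷ All.map (λ z≤y → ≤-trans z≤y (<⇒≤ y<x)) ys≤y)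
                ∷ merge-nonincreasing xs↘ (ys≤y ∷ ys↘)
  ... | no  y≮x = merge-All (≮⇒≥ y≮x ∷ All.map (λ z≤x → ≤-trans z≤x (≮⇒≥ y≮x)) xs≤x) ys≤y
                ∷ go ys↘

module _ {P : ℕ → Set} (P? : Decidable P) where

  filter-merge : ∀ {xs ys} → All P xs → All (∁ P) ys → filter P? (merge xs ys) ≡ xs
  filter-merge {[]}     _             ¬P[ys] = filter-none P? ¬P[ys]
  filter-merge {x ∷ xs} P[x∷xs]@(Px ∷ P[xs]) = go
    where
    go : ∀ {ys} → All (∁ P) ys → filter P? (merge (x ∷ xs) ys) ≡ x ∷ xs
    go {[]}     _              = filter-all P? P[x∷xs]
    go {y ∷ ys} (¬Py ∷ ¬P[ys]) with y <? x
    ... | yes _ = trans (filter-accept P? Px) (cong (x ∷_) (filter-merge P[xs] (¬Py ∷ ¬P[ys])))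
    ... | no  _ = trans (filter-reject P? ¬Py) (go ¬P[ys])

  filter-∁-merge : ∀ {xs ys} → All P xs → All (∁ P) ys → filter (∁? P?) (merge xs ys) ≡ ys
  filter-∁-merge {[]}     _             ¬P[ys] = filter-all (∁? P?) ¬P[ys]
  filter-∁-merge {x ∷ xs} P[x∷xs]@(Px ∷ P[xs]) = go
    where
    go : ∀ {ys} → All (∁ P) ys → filter (∁? P?) (merge (x ∷ xs) ys) ≡ ys
    go {[]}     _              = filter-none (∁? P?) (All.map (λ Pz ¬Pz → ¬Pz Pz) P[x∷xs])
    go {y ∷ ys} (¬Py ∷ ¬P[ys]) with y <? x
    ... | yes _ = trans (filter-reject (∁? P?) (λ ¬Px → ¬Px Px)) (filter-∁-merge P[xs] (¬Py ∷ ¬P[ys]))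
    ... | no  _ = trans (filter-accept (∁? P?) ¬Py) (cong (y ∷_) (go ¬P[ys]))

  merge-filter : ∀ xs → Decreasing xs → merge (filter P? xs) (filter (∁? P?) xs) ≡ xs
  merge-filter []       _           = refl
  merge-filter (x ∷ xs) (xs<x ∷ xs↘) with P? x
  ... | yes _ = trans (merge-∷ˡ x _ _ (All.filter⁺ P? (All.map <⇒≤ xs<x)) (All.filter⁺ (∁? P?) (All.map <⇒≤ xs<x)))
                      (cong (x ∷_) (merge-filter xs xs↘))
  ... | no  _ = trans (merge-∷ʳ _ x _ (All.filter⁺ P? (All.map <⇒≤ xs<x)))
                      (cong (x ∷_) (merge-filter xs xs↘))

-- Glaisher's bijection

IsOdd : ℕ → Set
IsOdd n = parity n ≡ 1ℙ

isOdd? : Decidable IsOdd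
isOdd? n = parity n ℙ.≟ 1ℙ

odd⇒positive : ∀ {n} → IsOdd n → 1 ≤ n
odd⇒positive {suc n} _ = s≤s z≤n

double : ℕ → ℕ
double zero    = zero
double (suc k) = suc (suc (double k))

double≡2* : ∀ k → double k ≡ 2 * k
double≡2* zero    = refl
double≡2* (suc k) = cong suc (trans (cong suc (double≡2* k)) (sym (+-suc k (k + 0))))

double-+ : ∀ m n → double (m + n) ≡ double m + double n
double-+ zero    n = refl
double-+ (suc m) n = cong (suc ∘ suc) (double-+ m n)

double-mono-< : ∀ {m n} → m < n → double m < double n
double-mono-< {zero}  {suc n} _         = s≤s z≤n
double-mono-< {suc m} {suc n} (s≤s m<n) = s≤s (s≤s (double-mono-< m<n))

double-positive : ∀ {n} → 1 ≤ n → 1 ≤ double n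
double-positive {suc n} _ = s≤s z≤n

double-≤-suc : ∀ {s f} → double s ≤ suc f → s ≤ f
double-≤-suc {zero}          _                = z≤n
double-≤-suc {suc s} {suc f} (s≤s (s≤s 2s≤f)) = s≤s (double-≤-suc (m≤n⇒m≤1+n 2s≤f))

double-even : ∀ k → ¬ IsOdd (double k)
double-even zero    ()
double-even (suc k) = double-even k

⌊double/2⌋ : ∀ k → ⌊ double k /2⌋ ≡ k
⌊double/2⌋ zero    = refl
⌊double/2⌋ (suc k) = cong suc (⌊double/2⌋ k)

double⌊/2⌋ : ∀ n → ¬ IsOdd n → double ⌊ n /2⌋ ≡ n
double⌊/2⌋ zero          _    = refl
double⌊/2⌋ (suc zero)    even = contradiction refl even
double⌊/2⌋ (suc (suc n)) even = cong (suc ∘ suc) (double⌊/2⌋ n even)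

⌊/2⌋-mono-< : ∀ {m n} → ¬ IsOdd n → m < n → ⌊ m /2⌋ < ⌊ n /2⌋
⌊/2⌋-mono-< {_}           {suc zero}    even _               = contradiction refl even
⌊/2⌋-mono-< {zero}        {suc (suc n)} _    _               = s≤s z≤n
⌊/2⌋-mono-< {suc zero}    {suc (suc n)} _    _               = s≤s z≤n
⌊/2⌋-mono-< {suc (suc m)} {suc (suc n)} even (s≤s (s≤s m<n)) = s≤s (⌊/2⌋-mono-< even m<n)

⌊/2⌋-positive : ∀ {n} → ¬ IsOdd n → 1 ≤ n → 1 ≤ ⌊ n /2⌋
⌊/2⌋-positive {suc zero}    even _ = contradiction refl even
⌊/2⌋-positive {suc (suc n)} _    _ = s≤s z≤n

suc-double-odd : ∀ k → IsOdd (suc (double k))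
suc-double-odd zero    = refl
suc-double-odd (suc k) = suc-double-odd k

odd≡suc-double : ∀ {n} → IsOdd n → n ≡ suc (double ⌊ n /2⌋)
odd≡suc-double {suc zero}    _   = refl
odd≡suc-double {suc (suc n)} odd = cong (suc ∘ suc) (odd≡suc-double {n} odd)

Odd⇒IsOdd : ∀ {n} → Odd n → IsOdd n
Odd⇒IsOdd (k , refl) = subst (IsOdd ∘ suc) (double≡2* k) (suc-double-odd k)

IsOdd⇒Odd : ∀ {n} → IsOdd n → Odd n
IsOdd⇒Odd {n} odd = ⌊ n /2⌋ , trans (odd≡suc-double odd) (cong suc (double≡2* ⌊ n /2⌋))

odds evens : List ℕ → List ℕ
odds  = filter isOdd?
evens = filter (∁? isOdd?)

map-double-⌊/2⌋ : ∀ {xs} → All (∁ IsOdd) xs → map double (map ⌊_/2⌋ xs) ≡ xs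
map-double-⌊/2⌋ []             = refl
map-double-⌊/2⌋ (even ∷ evens) = cong₂ _∷_ (double⌊/2⌋ _ even) (map-double-⌊/2⌋ evens)

map-⌊/2⌋-double : ∀ xs → map ⌊_/2⌋ (map double xs) ≡ xs
map-⌊/2⌋-double []       = refl
map-⌊/2⌋-double (x ∷ xs) = cong₂ _∷_ (⌊double/2⌋ x) (map-⌊/2⌋-double xs)

halve-decreasing : ∀ {xs} → All (∁ IsOdd) xs → Decreasing xs → Decreasing (map ⌊_/2⌋ xs)
halve-decreasing []             []           = []
halve-decreasing (even ∷ evens) (xs<x ∷ xs↘) =
  All.map⁺ (All.map (⌊/2⌋-mono-< even) xs<x) ∷ halve-decreasing evens xs↘

halve-positive : ∀ {xs} → All (∁ IsOdd) xs → Positive xs → Positive (map ⌊_/2⌋ xs)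
halve-positive []             []         = []
halve-positive (even ∷ evens) (x⁺ ∷ xs⁺) = ⌊/2⌋-positive even x⁺ ∷ halve-positive evens xs⁺

sum-map-double : ∀ xs → sum (map double xs) ≡ double (sum xs)
sum-map-double []       = refl
sum-map-double (x ∷ xs) = trans (cong (double x +_) (sum-map-double xs)) (sym (double-+ x (sum xs)))

halvedEvens : List ℕ → List ℕ
halvedEvens = map ⌊_/2⌋ ∘ evens

halvedEvens-decreasing : ∀ xs → Decreasing xs → Decreasing (halvedEvens xs)
halvedEvens-decreasing xs xs↘ =
  halve-decreasing (All.all-filter (∁? isOdd?) xs) (AllPairs.filter⁺ (∁? isOdd?) xs↘)

halvedEvens-positive : ∀ xs → Positive xs → Positive (halvedEvens xs)
halvedEvens-positive xs xs⁺ = halve-positive (All.all-filter (∁? isOdd?) xs) (All.filter⁺ (∁? isOdd?) xs⁺)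

sum-odds-halvedEvens : ∀ xs → Decreasing xs → sum (odds xs) + double (sum (halvedEvens xs)) ≡ sum xs
sum-odds-halvedEvens xs xs↘ = begin
  sum (odds xs) + double (sum (halvedEvens xs))
    ≡⟨ cong (sum (odds xs) +_) (sum-map-double (halvedEvens xs)) ⟨
  sum (odds xs) + sum (map double (halvedEvens xs))
    ≡⟨ cong ((sum (odds xs) +_) ∘ sum) (map-double-⌊/2⌋ (All.all-filter (∁? isOdd?) xs)) ⟩
  sum (odds xs) + sum (evens xs)
    ≡⟨ sum-merge (odds xs) (evens xs) ⟨
  sum (merge (odds xs) (evens xs))
    ≡⟨ cong sum (merge-filter isOdd? xs xs↘) ⟩
  sum xs ∎
  where open ≡-Reasoning

sum-halvedEvens-≤ : ∀ {f} xs → Decreasing xs → sum xs ≤ suc f → sum (halvedEvens xs) ≤ f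
sum-halvedEvens-≤ xs xs↘ Σ≤ =
  double-≤-suc (≤-trans (m≤n+m _ _) (≤-trans (≤-reflexive (sum-odds-halvedEvens xs xs↘)) Σ≤))

duplicate : List ℕ → List ℕ
duplicate []       = []
duplicate (x ∷ xs) = x ∷ x ∷ duplicate xs

duplicate-All : ∀ {P : ℕ → Set} {xs} → All P xs → All P (duplicate xs)
duplicate-All []           = []
duplicate-All (Px ∷ P[xs]) = Px ∷ Px ∷ duplicate-All P[xs]

duplicate-nonincreasing : ∀ {xs} → Nonincreasing xs → Nonincreasing (duplicate xs)
duplicate-nonincreasing []           = []
duplicate-nonincreasing (xs≤x ∷ xs↘) =
  (≤-refl ∷ duplicate-All xs≤x) ∷ duplicate-All xs≤x ∷ duplicate-nonincreasing xs↘

sum-duplicate : ∀ xs → sum (duplicate xs) ≡ double (sum xs)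
sum-duplicate []       = refl
sum-duplicate (x ∷ xs) = begin
  x + (x + sum (duplicate xs)) ≡⟨ cong (λ s → x + (x + s)) (sum-duplicate xs) ⟩
  x + (x + double (sum xs))    ≡⟨ +-assoc x x _ ⟨
  x + x + double (sum xs)      ≡⟨ cong (_+ double (sum xs)) double≡+ ⟨
  double x + double (sum xs)   ≡⟨ double-+ x (sum xs) ⟨
  double (x + sum xs)          ∎
  where
  open ≡-Reasoning
  double≡+ = trans (double≡2* x) (cong (x +_) (+-identityʳ x))

-- unpair μ = (singles μ , pairs μ) satisfies μ = merge (singles μ) (duplicate (pairs μ))
-- for nonincreasing μ: a part equal to the largest current single is paired off with it.
addPart : ℕ → List ℕ × List ℕ → List ℕ × List ℕ
addPart x ([]     , ps) = x ∷ [] , ps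
addPart x (y ∷ ss , ps) with x ≟ y
... | yes _ = ss , x ∷ ps
... | no  _ = x ∷ y ∷ ss , ps

unpair : List ℕ → List ℕ × List ℕ
unpair = foldr addPart ([] , [])

singles pairs : List ℕ → List ℕ
singles = proj₁ ∘ unpair
pairs   = proj₂ ∘ unpair

addPart-All : ∀ {P : ℕ → Set} {x} ss ps → P x → All P ss → All P ps →
              All P (proj₁ (addPart x (ss , ps))) × All P (proj₂ (addPart x (ss , ps)))
addPart-All         []       ps Px P[ss]        P[ps] = Px ∷ [] , P[ps]
addPart-All {x = x} (y ∷ ss) ps Px (Py ∷ P[ss]) P[ps] with x ≟ y
... | yes _ = P[ss] , Px ∷ P[ps]
... | no  _ = Px ∷ Py ∷ P[ss] , P[ps]

unpair-All : ∀ {P : ℕ → Set} μ → All P μ → All P (singles μ) × All P (pairs μ)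
unpair-All []      []          = [] , []
unpair-All (x ∷ μ) (Px ∷ P[μ]) = let (P[ss] , P[ps]) = unpair-All μ P[μ] in
                                 addPart-All (singles μ) (pairs μ) Px P[ss] P[ps]

addPart-shape : ∀ {x} ss ps → All (_≤ x) ss → All (_≤ x) ps → Decreasing ss → Nonincreasing ps →
                Decreasing (proj₁ (addPart x (ss , ps))) × Nonincreasing (proj₂ (addPart x (ss , ps)))
addPart-shape         []       ps _            _    _    ps↘ = [] ∷ [] , ps↘
addPart-shape {x = x} (y ∷ ss) ps (y≤x ∷ ss≤x) ps≤x ss↘ ps↘ with x ≟ y
... | yes _   = AllPairs.tail ss↘ , ps≤x ∷ ps↘
... | no  x≢y = (y<x ∷ All.map (λ z<y → <-trans z<y y<x) (AllPairs.head ss↘)) ∷ ss↘ , ps↘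
  where y<x = ≤∧≢⇒< y≤x (x≢y ∘ sym)

unpair-shape : ∀ μ → Nonincreasing μ → Decreasing (singles μ) × Nonincreasing (pairs μ)
unpair-shape []      _           = [] , []
unpair-shape (x ∷ μ) (μ≤x ∷ μ↘) =
  let (ss↘ , ps↘) = unpair-shape μ μ↘
      (ss≤x , ps≤x) = unpair-All μ μ≤x
  in addPart-shape (singles μ) (pairs μ) ss≤x ps≤x ss↘ ps↘

addPart-merge : ∀ {x} ss ps → All (_≤ x) ss → All (_≤ x) ps →
                merge (proj₁ (addPart x (ss , ps))) (duplicate (proj₂ (addPart x (ss , ps))))
                ≡ x ∷ merge ss (duplicate ps)
addPart-merge {x} []       ps _            ps≤x = merge-∷ˡ x [] _ [] (duplicate-All ps≤x)
addPart-merge {x} (y ∷ ss) ps (y≤x ∷ ss≤x) ps≤x with x ≟ y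
... | yes refl = begin
  merge ss (x ∷ x ∷ duplicate ps) ≡⟨ merge-∷ʳ ss x _ ss≤x ⟩
  x ∷ merge ss (x ∷ duplicate ps) ≡⟨ cong (x ∷_) (merge-∷ʳ ss x _ ss≤x) ⟩
  x ∷ x ∷ merge ss (duplicate ps) ≡⟨ cong (x ∷_) (merge-∷ˡ x ss _ ss≤x (duplicate-All ps≤x)) ⟨
  x ∷ merge (x ∷ ss) (duplicate ps) ∎
  where open ≡-Reasoning
... | no  _    = merge-∷ˡ x (y ∷ ss) _ (y≤x ∷ ss≤x) (duplicate-All ps≤x)

merge-unpair : ∀ μ → Nonincreasing μ → merge (singles μ) (duplicate (pairs μ)) ≡ μ
merge-unpair []      _          = refl
merge-unpair (x ∷ μ) (μ≤x ∷ μ↘) = let (ss≤x , ps≤x) = unpair-All μ μ≤x in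
  trans (addPart-merge (singles μ) (pairs μ) ss≤x ps≤x) (cong (x ∷_) (merge-unpair μ μ↘))

addPart-fresh : ∀ {x} ss ps → All (_< x) ss → addPart x (ss , ps) ≡ (x ∷ ss , ps)
addPart-fresh         []       ps _         = refl
addPart-fresh {x = x} (y ∷ ss) ps (y<x ∷ _) with x ≟ y
... | yes refl = contradiction y<x (<-irrefl refl)
... | no  _    = refl

addPart-twice : ∀ {x} ss ps → Decreasing ss → addPart x (addPart x (ss , ps)) ≡ (ss , x ∷ ps)
addPart-twice {x} []       ps _ with x ≟ x
... | yes _   = refl
... | no  x≢x = contradiction refl x≢x
addPart-twice {x} (y ∷ ss) ps (ss<y ∷ _) with x ≟ y
... | yes refl = addPart-fresh ss (x ∷ ps) ss<y
... | no  _ with x ≟ x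
...   | yes _   = refl
...   | no  x≢x = contradiction refl x≢x

unpair-decreasing : ∀ ss → Decreasing ss → unpair ss ≡ (ss , [])
unpair-decreasing []       _            = refl
unpair-decreasing (x ∷ ss) (ss<x ∷ ss↘) =
  trans (cong (addPart x) (unpair-decreasing ss ss↘)) (addPart-fresh ss [] ss<x)

unpair-merge : ∀ ss ps → Decreasing ss → unpair (merge ss (duplicate ps)) ≡ (ss , ps)
unpair-merge ss []       ss↘ = trans (cong unpair (merge-[]ʳ ss)) (unpair-decreasing ss ss↘)
unpair-merge ss (p ∷ ps) ss↘ = go ss ss↘
  where
  go : ∀ ss → Decreasing ss → unpair (merge ss (p ∷ p ∷ duplicate ps)) ≡ (ss , p ∷ ps)
  go [] _ = trans (cong (addPart p ∘ addPart p) (unpair-merge [] ps [])) (addPart-twice [] ps [])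
  go (s ∷ ss) (ss<s ∷ ss↘) with p <? s
  ... | yes _   = trans (cong (addPart s) (go ss ss↘))
                        (addPart-fresh ss (p ∷ ps) ss<s)
  ... | no  p≮s = begin
    unpair (p ∷ merge (s ∷ ss) (p ∷ duplicate ps))
      ≡⟨ cong (unpair ∘ (p ∷_)) (merge-∷ʳ (s ∷ ss) p _ s∷ss≤p) ⟩
    addPart p (addPart p (unpair (merge (s ∷ ss) (duplicate ps))))
      ≡⟨ cong (addPart p ∘ addPart p) (unpair-merge (s ∷ ss) ps (ss<s ∷ ss↘)) ⟩
    addPart p (addPart p (s ∷ ss , ps))
      ≡⟨ addPart-twice (s ∷ ss) ps (ss<s ∷ ss↘) ⟩
    (s ∷ ss , p ∷ ps) ∎
    where
    open ≡-Reasoning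
    s≤p = ≮⇒≥ p≮s
    s∷ss≤p = s≤p ∷ All.map (λ z<s → ≤-trans (<⇒≤ z<s) s≤p) ss<s

sum-unpair : ∀ μ → Nonincreasing μ → sum (singles μ) + double (sum (pairs μ)) ≡ sum μ
sum-unpair μ μ↘ = begin
  sum (singles μ) + double (sum (pairs μ))        ≡⟨ cong (sum (singles μ) +_) (sum-duplicate (pairs μ)) ⟨
  sum (singles μ) + sum (duplicate (pairs μ))     ≡⟨ sum-merge (singles μ) _ ⟨
  sum (merge (singles μ) (duplicate (pairs μ)))   ≡⟨ cong sum (merge-unpair μ μ↘) ⟩
  sum μ                                           ∎
  where open ≡-Reasoning

sum-pairs-≤ : ∀ {f} μ → Nonincreasing μ → sum μ ≤ suc f → sum (pairs μ) ≤ f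
sum-pairs-≤ μ μ↘ Σ≤ = double-≤-suc (≤-trans (m≤n+m _ _) (≤-trans (≤-reflexive (sum-unpair μ μ↘)) Σ≤))

positive-sum≤0 : ∀ {xs} → Positive xs → sum xs ≤ 0 → xs ≡ []
positive-sum≤0 []         _   = refl
positive-sum≤0 (x⁺ ∷ xs⁺) Σ≤0 = contradiction (≤-trans x⁺ (≤-trans (m≤m+n _ _) Σ≤0)) λ ()

-- The fuel f only has to be at least the sum of the argument, which halves at each recursive call.
glaisher : ℕ → List ℕ → List ℕ
glaisher zero    _ = []
glaisher (suc f) l = merge (odds l) (duplicate (glaisher f (halvedEvens l)))

glaisher⁻¹ : ℕ → List ℕ → List ℕ
glaisher⁻¹ zero    _ = []
glaisher⁻¹ (suc f) μ = merge (singles μ) (map double (glaisher⁻¹ f (pairs μ)))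

glaisher-odd : ∀ f l → Decreasing l → Positive l → sum l ≤ f →
               Nonincreasing (glaisher f l) × All IsOdd (glaisher f l) × sum (glaisher f l) ≡ sum l
glaisher-odd zero l _ l⁺ Σ≤ with positive-sum≤0 l⁺ Σ≤
... | refl = [] , [] , refl
glaisher-odd (suc f) l l↘ l⁺ Σ≤
  with glaisher-odd f (halvedEvens l) (halvedEvens-decreasing l l↘) (halvedEvens-positive l l⁺)
                    (sum-halvedEvens-≤ l l↘ Σ≤)
... | g↘ , g-odd , Σg =
  merge-nonincreasing (AllPairs.map <⇒≤ (AllPairs.filter⁺ isOdd? l↘)) (duplicate-nonincreasing g↘) ,
  merge-All (All.all-filter isOdd? l) (duplicate-All g-odd) ,
  (begin
    sum (merge (odds l) (duplicate g))          ≡⟨ sum-merge (odds l) _ ⟩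
    sum (odds l) + sum (duplicate g)            ≡⟨ cong (sum (odds l) +_) (sum-duplicate g) ⟩
    sum (odds l) + double (sum g)               ≡⟨ cong ((sum (odds l) +_) ∘ double) Σg ⟩
    sum (odds l) + double (sum (halvedEvens l)) ≡⟨ sum-odds-halvedEvens l l↘ ⟩
    sum l                                       ∎)
  where
  open ≡-Reasoning
  g = glaisher f (halvedEvens l)

glaisher⁻¹-distinct : ∀ f μ → Nonincreasing μ → All IsOdd μ → sum μ ≤ f →
                      Decreasing (glaisher⁻¹ f μ) × Positive (glaisher⁻¹ f μ)
                      × sum (glaisher⁻¹ f μ) ≡ sum μ
glaisher⁻¹-distinct zero μ _ μ-odd Σ≤ with positive-sum≤0 (All.map odd⇒positive μ-odd) Σ≤
... | refl = [] , [] , refl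
glaisher⁻¹-distinct (suc f) μ μ↘ μ-odd Σ≤
  with unpair-shape μ μ↘ | unpair-All μ μ-odd
... | ss↘ , ps↘ | ss-odd , ps-odd
  with glaisher⁻¹-distinct f (pairs μ) ps↘ ps-odd (sum-pairs-≤ μ μ↘ Σ≤)
... | h↘ , h⁺ , Σh =
  merge-decreasing ss-odd (All.map⁺ (All.universal double-even h))
                   ss↘ (AllPairs.map⁺ (AllPairs.map double-mono-< h↘)) ,
  merge-All (All.map odd⇒positive ss-odd) (All.map⁺ (All.map double-positive h⁺)) ,
  (begin
    sum (merge (singles μ) (map double h))   ≡⟨ sum-merge (singles μ) _ ⟩
    sum (singles μ) + sum (map double h)     ≡⟨ cong (sum (singles μ) +_) (sum-map-double h) ⟩
    sum (singles μ) + double (sum h)         ≡⟨ cong ((sum (singles μ) +_) ∘ double) Σh ⟩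
    sum (singles μ) + double (sum (pairs μ)) ≡⟨ sum-unpair μ μ↘ ⟩
    sum μ                                    ∎)
  where
  open ≡-Reasoning
  h = glaisher⁻¹ f (pairs μ)

glaisher⁻¹-glaisher : ∀ f l → Decreasing l → Positive l → sum l ≤ f → glaisher⁻¹ f (glaisher f l) ≡ l
glaisher⁻¹-glaisher zero l _ l⁺ Σ≤ = sym (positive-sum≤0 l⁺ Σ≤)
glaisher⁻¹-glaisher (suc f) l l↘ l⁺ Σ≤ = begin
  glaisher⁻¹ (suc f) (merge (odds l) (duplicate g))
    ≡⟨ cong (λ (ss , ps) → merge ss (map double (glaisher⁻¹ f ps)))
            (unpair-merge (odds l) g (AllPairs.filter⁺ isOdd? l↘)) ⟩
  merge (odds l) (map double (glaisher⁻¹ f g))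
    ≡⟨ cong (merge (odds l) ∘ map double) (glaisher⁻¹-glaisher f h h↘ h⁺ Σh≤f) ⟩
  merge (odds l) (map double (halvedEvens l))
    ≡⟨ cong (merge (odds l)) (map-double-⌊/2⌋ (All.all-filter (∁? isOdd?) l)) ⟩
  merge (odds l) (evens l)
    ≡⟨ merge-filter isOdd? l l↘ ⟩
  l ∎
  where
  open ≡-Reasoning
  h = halvedEvens l
  g = glaisher f h
  h↘ = halvedEvens-decreasing l l↘
  h⁺ = halvedEvens-positive l l⁺
  Σh≤f = sum-halvedEvens-≤ l l↘ Σ≤

glaisher-glaisher⁻¹ : ∀ f μ → Nonincreasing μ → All IsOdd μ → sum μ ≤ f → glaisher f (glaisher⁻¹ f μ) ≡ μ
glaisher-glaisher⁻¹ zero μ _ μ-odd Σ≤ = sym (positive-sum≤0 (All.map odd⇒positive μ-odd) Σ≤)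
glaisher-glaisher⁻¹ (suc f) μ μ↘ μ-odd Σ≤ = begin
  glaisher (suc f) (merge (singles μ) (map double h))
    ≡⟨ cong₂ (λ ss es → merge ss (duplicate (glaisher f (map ⌊_/2⌋ es))))
             (filter-merge isOdd? ss-odd hs-even) (filter-∁-merge isOdd? ss-odd hs-even) ⟩
  merge (singles μ) (duplicate (glaisher f (map ⌊_/2⌋ (map double h))))
    ≡⟨ cong (merge (singles μ) ∘ duplicate ∘ glaisher f) (map-⌊/2⌋-double h) ⟩
  merge (singles μ) (duplicate (glaisher f h))
    ≡⟨ cong (merge (singles μ) ∘ duplicate) (glaisher-glaisher⁻¹ f (pairs μ) ps↘ ps-odd Σps≤f) ⟩
  merge (singles μ) (duplicate (pairs μ))
    ≡⟨ merge-unpair μ μ↘ ⟩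
  μ ∎
  where
  open ≡-Reasoning
  h = glaisher⁻¹ f (pairs μ)
  ss-odd = proj₁ (unpair-All μ μ-odd)
  ps-odd = proj₂ (unpair-All μ μ-odd)
  ps↘ = proj₂ (unpair-shape μ μ↘)
  hs-even = All.map⁺ (All.universal double-even h)
  Σps≤f = sum-pairs-≤ μ μ↘ Σ≤

oddPartitions-hasSize : ∀ n → HasSize _≡_ (IsOddPartition n) (length (distinctPartitions n))
oddPartitions-hasSize n = HasSize-map (glaisher n) to-odd injective onto (distinctPartitions-hasSize n)
  where
  to-odd : ∀ {l} → IsDistinctPartition n l → IsOddPartition n (glaisher n l)
  to-odd {l} (l↘ , l⁺ , Σl) =
    let (g↘ , g-odd , Σg) = glaisher-odd n l l↘ l⁺ (≤-reflexive Σl)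
    in g↘ , All.map IsOdd⇒Odd g-odd , trans Σg Σl
  injective : ∀ {a b} → IsDistinctPartition n a → IsDistinctPartition n b →
              glaisher n a ≡ glaisher n b → a ≡ b
  injective {a} {b} (a↘ , a⁺ , Σa) (b↘ , b⁺ , Σb) eq =
    trans (sym (glaisher⁻¹-glaisher n a a↘ a⁺ (≤-reflexive Σa)))
          (trans (cong (glaisher⁻¹ n) eq) (glaisher⁻¹-glaisher n b b↘ b⁺ (≤-reflexive Σb)))
  onto : ∀ {μ} → IsOddPartition n μ → Σ (List ℕ) λ l → IsDistinctPartition n l × μ ≡ glaisher n l
  onto {μ} (μ↘ , μ-odd , Σμ) =
    let (h↘ , h⁺ , Σh) = glaisher⁻¹-distinct n μ μ↘ (All.map Odd⇒IsOdd μ-odd) (≤-reflexive Σμ)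
    in glaisher⁻¹ n μ , (h↘ , h⁺ , trans Σh Σμ) ,
       sym (glaisher-glaisher⁻¹ n μ μ↘ (All.map Odd⇒IsOdd μ-odd) (≤-reflexive Σμ))

corollary2p4 : (n : ℕ) → 1 ≤ n →
    Σ ℕ λ m →
      HasSize _≗ₛ_ (InΔ n) m
      × HasSize _≡_ (IsDistinctPartition n) m
      × HasSize _≡_ (IsOddPartition n) m
corollary2p4 n _ =
  length (distinctPartitions n) ,
  Δ-hasSize n ,
  distinctPartitions-hasSize n ,
  oddPartitions-hasSize n
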